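{- Let $\langle \mathcal{N},\mathcal{D},\theta\rangle$ be a $d$-dimensional sandpile model with complete neighborhood and $r=\max\{|v|_\infty : v\in\mathcal{N}\}$. Let $c$ be a configuration supported on the elementary hypercube $\{0,\dots,n-1\}^d$ with $c(x)<2\theta$ for every $x$. If $c\to^* c'$, then $c'(x)=0$ for every $x\in\mathbb{Z}^d$ with $|x|_\infty>4\theta r n^d$.
   Context: A $d$-dimensional sandpile model is a triple $\langle \mathcal{N},\mathcal{D},\theta\rangle$ with $\mathcal{N}$ a finite subset of $\mathbb{Z}^d\setminus\{0^d\}$, $\mathcal{D}:\mathcal{N}\to\mathbb{N}_+$, $\theta=\sum_{v\in\mathcal{N}}\mathcal{D}(v)$; completeness means nonnegative integer linear combinations of $\mathcal{N}$ give all of $\mathbb{Z}^d$. The global rule is $F(c)(x)=c(x)-\theta H(c(x)-\theta)+\sum_{v\in\mathcal{N}}\mathcal{D}(v)H(c(x+v)-\theta)$ with $H(m)=1$ if $m\ge0$, else $0$. $c\to c'$ means $c'=F(c)$ and $\to^*$ is its reflexive transitive closure. -}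

module Defs where

open import Data.Nat as ℕ using (ℕ; zero; suc; _∸_; _≤_; _<_; _^_; _⊔_; _≤?_)
open import Data.Integer as ℤ using (ℤ; +_; ∣_∣)
open import Data.Vec as Vec using (Vec; zipWith; replicate; lookup; foldr)
open import Data.Fin using (Fin)
open import Data.List as List using (List; length)
open import Data.List.Relation.Unary.All using (All)
open import Data.Nat.ListAction using (sum)
open import Data.List.Relation.Unary.Unique.Propositional using (Unique)
open import Data.Product using (_×_; _,_; proj₁; proj₂; ∃)
open import Relation.Binary.PropositionalEquality using (_≡_; _≢_)
open import Relation.Nullary using (yes; no)
open import Relation.Binary.Construct.Closure.ReflexiveTransitive using (Star)

Point : ℕ → Set
Point d = Vec ℤ d

origin : ∀ {d} → Point d
origin = replicate _ (+ 0)

_⊕_ : ∀ {d} → Point d → Point d → Point d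
_⊕_ = zipWith ℤ._+_

_·_ : ∀ {d} → ℕ → Point d → Point d
k · v = Vec.map (λ z → + k ℤ.* z) v

∥_∥∞ : ∀ {d} → Point d → ℕ
∥ x ∥∞ = foldr _ (λ z m → ∣ z ∣ ⊔ m) 0 x

-- A d-dimensional sandpile model: the finite neighbourhood 𝒩 ⊆ ℤ^d ∖ {0}
-- together with the weights 𝒟 : 𝒩 → ℕ₊, given as a duplicate-free list
-- of pairs (v , 𝒟 v).
record Sandpile (d : ℕ) : Set where
  field
    nbhd     : List (Point d × ℕ)
    distinct : Unique (List.map proj₁ nbhd)
    nonzero  : All (λ p → proj₁ p ≢ origin) nbhd
    positive : All (λ p → 1 ≤ proj₂ p) nbhd

  θ : ℕ
  θ = sum (List.map proj₂ nbhd)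

  r : ℕ
  r = List.foldr (λ p m → ∥ proj₁ p ∥∞ ⊔ m) 0 nbhd

  Complete : Set
  Complete = ∀ (z : Point d) → ∃ λ (k : Fin (length nbhd) → ℕ) →
    List.foldr _⊕_ origin
      (List.map (λ i → k i · proj₁ (List.lookup nbhd i)) (List.allFin (length nbhd)))
      ≡ z

  Config : Set
  Config = Point d → ℕ

  -- H(m) with m = a - θ : 1 iff a ≥ θ
  H : ℕ → ℕ
  H a with θ ≤? a
  ... | yes _ = 1
  ... | no  _ = 0

  -- global rule F (all quantities are nonnegative; c(x) - θ H(c(x)-θ) is
  -- computed with truncated subtraction, which is exact here)
  F : Config → Config
  F c x = (c x ∸ θ ℕ.* H (c x))
          ℕ.+ sum (List.map (λ p → proj₂ p ℕ.* H (c (x ⊕ proj₁ p))) nbhd)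

  _⟶_ : Config → Config → Set
  c ⟶ c' = ∀ x → c' x ≡ F c x

  _⟶*_ : Config → Config → Set
  _⟶*_ = Star _⟶_

InCube : ∀ {d} → ℕ → Point d → Set
InCube n x = All (λ z → ∃ λ m → z ≡ + m × m < n) (Vec.toList x)

module Submission where

-- Fix a direction φ (a signed coordinate).  Two invariants of the global
-- rule F are established:
--   * mass: F never creates chips (Toppling.mass-step), so the total mass
--     stays at most M = n^d(2θ - 1);
--   * no gaps (Spreading.gapless-step): if some occupied site has height
--     ≥ p > n, then some occupied site lies in the window [p - 2r, p).  A
--     window site that empties has fired, and by completeness 𝒩 contains
--     vectors of positive and of negative height, so it refills the window.
-- Starting from an occupied site of height > n + 2rm and descending through
-- windows yields more than m chips, so heights stay ≤ n + 2rM
-- (Spreading.reach-bound).  The theorem follows by choosing the direction of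
-- a coordinate of maximal modulus and the estimate n + 2rM ≤ 4θrn^d.

open import Defs
open import Data.Nat using (ℕ)
open import Data.Integer using (ℤ)

module ListSums where

  open import Data.Nat using (ℕ; _+_; _*_; _≤_; _<_; z≤n; _≟_)
  open import Data.Nat.Properties
  open import Data.Nat.ListAction using (sum)
  open import Data.List using (List; []; _∷_; map; length)
  open import Data.List.Membership.Propositional using (_∈_)
  open import Data.List.Relation.Unary.Any as Any using (here; there)
  open import Data.List.Relation.Unary.All as All using ()
  open import Data.List.Relation.Unary.AllPairs using (_∷_)
  open import Data.List.Relation.Unary.Unique.Propositional using (Unique)
  open import Data.Product using (∃; _×_; _,_)
  open import Data.Empty using (⊥-elim)
  open import Relation.Nullary using (yes; no)
  open import Relation.Binary.PropositionalEquality
  open import Function using (_∘_)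
  open import Algebra.Properties.CommutativeSemigroup +-commutativeSemigroup using (interchange; x∙yz≈y∙xz)

  sumOver : ∀ {a} {A : Set a} → (A → ℕ) → List A → ℕ
  sumOver f xs = sum (map f xs)

  module _ {a} {A : Set a} where

    sumOver-cong : ∀ {f g : A → ℕ} xs → (∀ x → f x ≡ g x) → sumOver f xs ≡ sumOver g xs
    sumOver-cong []       f≡g = refl
    sumOver-cong (x ∷ xs) f≡g = cong₂ _+_ (f≡g x) (sumOver-cong xs f≡g)

    sumOver-mono : ∀ {f g : A → ℕ} xs → (∀ {x} → x ∈ xs → f x ≤ g x) → sumOver f xs ≤ sumOver g xs
    sumOver-mono []       f≤g = z≤n
    sumOver-mono (x ∷ xs) f≤g = +-mono-≤ (f≤g (here refl)) (sumOver-mono xs (f≤g ∘ there))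

    sumOver-strict : ∀ {f g : A → ℕ} xs {y} → (∀ x → f x ≤ g x) → y ∈ xs → f y < g y →
                     sumOver f xs < sumOver g xs
    sumOver-strict (x ∷ xs) f≤g (here refl) fy<gy = +-mono-<-≤ fy<gy (sumOver-mono xs (λ {z} _ → f≤g z))
    sumOver-strict (x ∷ xs) f≤g (there y∈) fy<gy = +-mono-≤-< (f≤g x) (sumOver-strict xs f≤g y∈ fy<gy)

    summand≤sumOver : ∀ (f : A → ℕ) {x} xs → x ∈ xs → f x ≤ sumOver f xs
    summand≤sumOver f (y ∷ xs) (here refl) = m≤m+n (f y) _
    summand≤sumOver f (y ∷ xs) (there x∈)  = ≤-trans (summand≤sumOver f xs x∈) (m≤n+m _ (f y))

    sumOver-nonzero : ∀ (f : A → ℕ) xs → sumOver f xs ≢ 0 → ∃ λ x → x ∈ xs × f x ≢ 0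
    sumOver-nonzero f []       s≢0 = ⊥-elim (s≢0 refl)
    sumOver-nonzero f (x ∷ xs) s≢0 with f x ≟ 0
    ... | no fx≢0 = x , here refl , fx≢0
    ... | yes fx≡0 with sumOver-nonzero f xs (λ s≡0 → s≢0 (cong₂ _+_ fx≡0 s≡0))
    ...   | y , y∈ , fy≢0 = y , there y∈ , fy≢0

    sumOver-+ : ∀ (f g : A → ℕ) xs → sumOver (λ x → f x + g x) xs ≡ sumOver f xs + sumOver g xs
    sumOver-+ f g []       = refl
    sumOver-+ f g (x ∷ xs) =
      trans (cong (f x + g x +_) (sumOver-+ f g xs)) (interchange (f x) (g x) (sumOver f xs) (sumOver g xs))

    sumOver-*ˡ : ∀ k (f : A → ℕ) xs → sumOver (λ x → k * f x) xs ≡ k * sumOver f xs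
    sumOver-*ˡ k f []       = sym (*-zeroʳ k)
    sumOver-*ˡ k f (x ∷ xs) = trans (cong (k * f x +_) (sumOver-*ˡ k f xs)) (sym (*-distribˡ-+ k (f x) _))

    sumOver-*ʳ : ∀ k (f : A → ℕ) xs → sumOver (λ x → f x * k) xs ≡ sumOver f xs * k
    sumOver-*ʳ k f []       = refl
    sumOver-*ʳ k f (x ∷ xs) = trans (cong (f x * k +_) (sumOver-*ʳ k f xs)) (sym (*-distribʳ-+ k (f x) _))

    sumOver-const : ∀ (f : A → ℕ) k xs → (∀ x → f x ≤ k) → sumOver f xs ≤ length xs * k
    sumOver-const f k []       f≤k = z≤n
    sumOver-const f k (x ∷ xs) f≤k = +-mono-≤ (f≤k x) (sumOver-const f k xs f≤k)

    sumOver-─ : ∀ (f : A → ℕ) {x} xs (x∈ : x ∈ xs) → sumOver f xs ≡ f x + sumOver f (xs Any.─ x∈)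
    sumOver-─ f (y ∷ xs) (here refl) = refl
    sumOver-─ f {x} (y ∷ xs) (there x∈) =
      trans (cong (f y +_) (sumOver-─ f xs x∈)) (x∙yz≈y∙xz (f y) (f x) (sumOver f (xs Any.─ x∈)))

    ∈-─ : ∀ {x z : A} (xs : List A) (x∈ : x ∈ xs) → z ∈ xs → z ≢ x → z ∈ (xs Any.─ x∈)
    ∈-─ (_ ∷ xs) (here refl) (here refl) z≢x = ⊥-elim (z≢x refl)
    ∈-─ (_ ∷ xs) (here refl) (there z∈)  z≢x = z∈
    ∈-─ (y ∷ xs) (there x∈)  (here refl) z≢x = here refl
    ∈-─ (y ∷ xs) (there x∈)  (there z∈)  z≢x = there (∈-─ xs x∈ z∈ z≢x)

    sumOver-⊆ : ∀ (f : A → ℕ) V U → Unique V → (∀ {y} → y ∈ V → f y ≢ 0 → y ∈ U) →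
                sumOver f V ≤ sumOver f U
    sumOver-⊆ f []      U _ _ = z≤n
    sumOver-⊆ f (y ∷ V) U (y∉V ∷ V!) V⊆U with f y ≟ 0
    ... | yes fy≡0 = subst (λ t → t + sumOver f V ≤ sumOver f U) (sym fy≡0)
                       (sumOver-⊆ f V U V! (V⊆U ∘ there))
    ... | no fy≢0 = begin
      f y + sumOver f V               ≤⟨ +-monoʳ-≤ (f y) (sumOver-⊆ f V (U Any.─ y∈U) V! V⊆U─y) ⟩
      f y + sumOver f (U Any.─ y∈U)   ≡⟨ sumOver-─ f U y∈U ⟨
      sumOver f U                     ∎
      where
        open ≤-Reasoning
        y∈U = V⊆U (here refl) fy≢0
        V⊆U─y : ∀ {z} → z ∈ V → f z ≢ 0 → z ∈ (U Any.─ y∈U)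
        V⊆U─y z∈V fz≢0 = ∈-─ U y∈U (V⊆U (there z∈V) fz≢0) (λ z≡y → All.lookup y∉V z∈V (sym z≡y))

  sumOver-map : ∀ {a b} {A : Set a} {B : Set b} (f : A → ℕ) (g : B → A) xs →
                sumOver f (map g xs) ≡ sumOver (λ x → f (g x)) xs
  sumOver-map f g []       = refl
  sumOver-map f g (x ∷ xs) = cong (f (g x) +_) (sumOver-map f g xs)

  sumOver-swap : ∀ {a b} {A : Set a} {B : Set b} (g : A → B → ℕ) (xs : List A) (ys : List B) →
                 sumOver (λ x → sumOver (g x) ys) xs ≡ sumOver (λ y → sumOver (λ x → g x y) xs) ys
  sumOver-swap g []       ys = sym (zeros ys)
    where
      zeros : ∀ ys → sumOver (λ _ → 0) ys ≡ 0
      zeros []       = refl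
      zeros (_ ∷ ys) = zeros ys
  sumOver-swap g (x ∷ xs) ys = trans (cong (sumOver (g x) ys +_) (sumOver-swap g xs ys))
                                     (sym (sumOver-+ (g x) (λ y → sumOver (λ x → g x y) xs) ys))

module Integers where

  import Data.Nat as ℕ
  open import Data.Integer as ℤ using (ℤ; +_; -[1+_]; _+_; _-_; _*_; -_; _≤_; _<_)
  import Data.Integer.Properties as ℤP
  open import Data.Integer.Tactic.RingSolver using (solve-∀)
  open import Data.List using (List; []; _∷_; foldr)
  open import Data.List.Membership.Propositional using (_∈_)
  open import Data.List.Relation.Unary.Any using (here; there)
  open import Data.Product using (∃; _×_; _,_)
  open import Data.Empty using (⊥-elim)
  open import Relation.Nullary using (yes; no)
  open import Relation.Binary.PropositionalEquality

  positive-summand : ∀ (as : List ℤ) → + 0 < foldr _+_ (+ 0) as → ∃ λ a → a ∈ as × + 0 < a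
  positive-summand [] (ℤ.+<+ ())
  positive-summand (a ∷ as) 0<sum with + 0 ℤP.<? a
  ... | yes 0<a = a , here refl , 0<a
  ... | no 0≮a with positive-summand as (ℤP.<-≤-trans 0<sum sum≤rest)
    where
      sum≤rest : a + foldr _+_ (+ 0) as ≤ foldr _+_ (+ 0) as
      sum≤rest = ℤP.≤-trans (ℤP.+-monoˡ-≤ (foldr _+_ (+ 0) as) (ℤP.≮⇒≥ 0≮a))
                            (ℤP.≤-reflexive (ℤP.+-identityˡ _))
  ...   | b , b∈ , 0<b = b , there b∈ , 0<b

  positive-factor : ∀ k a → + 0 < + k * a → + 0 < a
  positive-factor k a 0<ka with + 0 ℤP.<? a
  ... | yes 0<a = 0<a
  ... | no 0≮a  = ⊥-elim (ℤP.<-irrefl refl (ℤP.<-≤-trans 0<ka ka≤0))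
    where
      ka≤0 : + k * a ≤ + 0
      ka≤0 = ℤP.≤-trans (ℤP.*-monoˡ-≤-nonNeg (+ k) (ℤP.≮⇒≥ 0≮a)) (ℤP.≤-reflexive (ℤP.*-zeroʳ (+ k)))

  ∣∣≤⇒within : ∀ {a n} → ℤ.∣ a ∣ ℕ.≤ n → - + n ≤ a × a ≤ + n
  ∣∣≤⇒within {+ m}      {n}       m≤n         = ℤP.neg-≤-pos , ℤ.+≤+ m≤n
  ∣∣≤⇒within { -[1+ m ]} {ℕ.suc n} (ℕ.s≤s m≤n) = ℤ.-≤- m≤n , ℤ.-≤+

  InWindow : ℤ → ℤ → ℤ → Set
  InWindow R p t = p - (R + R) ≤ t × t < p

  private
    split-window : ∀ p R → p - (R + R) ≡ (p - R) + - R
    split-window = solve-∀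

  near⇒window : ∀ {R p t} → + 0 ≤ R → p - R ≤ t → t < p → InWindow R p t
  near⇒window {R} {p} {t} 0≤R p-R≤t t<p = lower , t<p
    where
      lower : p - (R + R) ≤ t
      lower = begin
        p - (R + R)     ≡⟨ split-window p R ⟩
        (p - R) + - R   ≤⟨ ℤP.+-monoʳ-≤ (p - R) (ℤP.neg-mono-≤ 0≤R) ⟩
        (p - R) + + 0   ≡⟨ ℤP.+-identityʳ (p - R) ⟩
        p - R           ≤⟨ p-R≤t ⟩
        t               ∎
        where open ℤP.≤-Reasoning

  descend-into-window : ∀ {R p t a} → p - R ≤ t → t < p → + 0 < a → a ≤ R → InWindow R p (t - a)
  descend-into-window {R} {p} {t} {a} p-R≤t t<p 0<a a≤R = lower , upper
    where
      lower : p - (R + R) ≤ t - a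
      lower = subst (_≤ t - a) (sym (split-window p R)) (ℤP.+-mono-≤ p-R≤t (ℤP.neg-mono-≤ a≤R))
      upper : t - a < p
      upper = ℤP.<-trans (subst (t - a <_) (ℤP.+-identityʳ t) (ℤP.+-monoʳ-< t (ℤP.neg-mono-< 0<a))) t<p

  ascend-into-window : ∀ {R p t a} → InWindow R p t → t < p - R → - R ≤ a → a < + 0 → InWindow R p (t - a)
  ascend-into-window {R} {p} {t} {a} (p-2R≤t , _) t<p-R -R≤a a<0 = lower , upper
    where
      lower : p - (R + R) ≤ t - a
      lower = ℤP.≤-trans p-2R≤t (subst (_≤ t - a) (ℤP.+-identityʳ t) (ℤP.+-monoʳ-≤ t (ℤP.<⇒≤ (ℤP.neg-mono-< a<0))))
      upper : t - a < p
      upper = subst (t - a <_) (back p R) (ℤP.+-mono-<-≤ t<p-R (subst (- a ≤_) (ℤP.neg-involutive R) (ℤP.neg-mono-≤ -R≤a)))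
        where
          back : ∀ p R → p - R + R ≡ p
          back = solve-∀

  exceeds-after-drop : ∀ {B w m h t} → B + (w + m) < h → h - w ≤ t → B + m < t
  exceeds-after-drop {B} {w} {m} {h} B+w+m<h h-w≤t =
    ℤP.<-≤-trans (subst (_< h - w) (shift B w m) (ℤP.+-monoˡ-< (- w) B+w+m<h)) h-w≤t
    where
      shift : ∀ B w m → B + (w + m) - w ≡ B + m
      shift = solve-∀

module Points where

  open import Data.Nat as ℕ using (_≤_; _<_)
  import Data.Nat.Properties as ℕP
  open import Data.Integer as ℤ using (+_; +[1+_]; -[1+_])
  import Data.Integer.Properties as ℤP
  open import Data.Integer.Tactic.RingSolver using (solve-∀)
  open import Data.Vec using ([]; _∷_; zipWith; lookup)
  import Data.Vec.Properties as VecP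
  open import Data.Fin using (zero; suc)
  open import Data.List.Relation.Unary.All using (_∷_)
  open import Data.Product using (∃; _×_; _,_)
  open import Data.Sum using (inj₁; inj₂)
  open import Data.Empty using (⊥-elim)
  open import Relation.Binary.PropositionalEquality
  open import Relation.Binary.Definitions using (DecidableEquality)

  _⊖_ : ∀ {d} → Point d → Point d → Point d
  _⊖_ = zipWith ℤ._-_

  ⊖-⊕ : ∀ {d} (x v : Point d) → (x ⊖ v) ⊕ v ≡ x
  ⊖-⊕ []      []      = refl
  ⊖-⊕ (a ∷ x) (b ∷ v) = cong₂ _∷_ (cancel a b) (⊖-⊕ x v)
    where
      cancel : ∀ a b → a ℤ.- b ℤ.+ b ≡ a
      cancel = solve-∀

  ⊕-⊖ : ∀ {d} (x v : Point d) → (x ⊕ v) ⊖ v ≡ x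
  ⊕-⊖ []      []      = refl
  ⊕-⊖ (a ∷ x) (b ∷ v) = cong₂ _∷_ (cancel a b) (⊕-⊖ x v)
    where
      cancel : ∀ a b → a ℤ.+ b ℤ.- b ≡ a
      cancel = solve-∀

  ⊕-injective : ∀ {d} (v : Point d) {x y} → x ⊕ v ≡ y ⊕ v → x ≡ y
  ⊕-injective v {x} {y} e = trans (sym (⊕-⊖ x v)) (trans (cong (_⊖ v) e) (⊕-⊖ y v))

  _≟ₚ_ : ∀ {d} → DecidableEquality (Point d)
  _≟ₚ_ = VecP.≡-dec ℤP._≟_

  ∣lookup∣≤∥∥∞ : ∀ {d} (v : Point d) i → ℤ.∣ lookup v i ∣ ≤ ∥ v ∥∞
  ∣lookup∣≤∥∥∞ (z ∷ v) zero    = ℕP.m≤m⊔n ℤ.∣ z ∣ _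
  ∣lookup∣≤∥∥∞ (z ∷ v) (suc i) = ℕP.≤-trans (∣lookup∣≤∥∥∞ v i) (ℕP.m≤n⊔m ℤ.∣ z ∣ _)

  ∥∥∞-attained : ∀ {d} (v : Point d) K → K < ∥ v ∥∞ → ∃ λ i → K < ℤ.∣ lookup v i ∣
  ∥∥∞-attained (z ∷ v) K K<∥v∥ with ℕP.⊔-sel ℤ.∣ z ∣ ∥ v ∥∞
  ... | inj₁ e = zero , subst (K <_) e K<∥v∥
  ... | inj₂ e with ∥∥∞-attained v K (subst (K <_) e K<∥v∥)
  ...   | i , K<∣vᵢ∣ = suc i , K<∣vᵢ∣

  ∥∥∞-positive : ∀ {d} (v : Point d) → v ≢ origin → 1 ≤ ∥ v ∥∞
  ∥∥∞-positive []              v≢0 = ⊥-elim (v≢0 refl)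
  ∥∥∞-positive (+ 0 ∷ v)       v≢0 =
    ℕP.≤-trans (∥∥∞-positive v (λ v≡0 → v≢0 (cong (+ 0 ∷_) v≡0))) (ℕP.m≤n⊔m 0 ∥ v ∥∞)
  ∥∥∞-positive (+[1+ k ] ∷ v)  _   = ℕP.≤-trans (ℕ.s≤s ℕ.z≤n) (ℕP.m≤m⊔n (ℕ.suc k) ∥ v ∥∞)
  ∥∥∞-positive (-[1+ k ] ∷ v)  _   = ℕP.≤-trans (ℕ.s≤s ℕ.z≤n) (ℕP.m≤m⊔n (ℕ.suc k) ∥ v ∥∞)

  InCube-lookup : ∀ {d} n (y : Point d) → InCube n y → ∀ i → ∃ λ m → lookup y i ≡ + m × m < n
  InCube-lookup n (z ∷ y) (z∈ ∷ _)  zero    = z∈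
  InCube-lookup n (z ∷ y) (_ ∷ y∈)  (suc i) = InCube-lookup n y y∈ i

-- The spreading argument measures how far chips
-- travel along such a φ; signed coordinates are the directions needed.
module Directions where

  open import Data.Nat as ℕ using (ℕ; _≤_)
  import Data.Nat.Properties as ℕP
  open import Data.Integer as ℤ using (ℤ; +_; -[1+_]; _+_; _-_; _*_; -_)
  import Data.Integer.Properties as ℤP
  open import Data.Integer.Tactic.RingSolver using (solve-∀)
  open import Data.Vec using (lookup; _[_]≔_)
  import Data.Vec.Properties as VecP
  open import Data.Fin using (Fin)
  open import Data.List as List using (List)
  open import Data.Product using (Σ; _×_; _,_)
  open import Relation.Binary.PropositionalEquality
  open Points

  record Direction (d : ℕ) : Set where
    field
      φ        : Point d → ℤ
      φ-⊕      : ∀ x y → φ (x ⊕ y) ≡ φ x + φ y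
      φ-origin : φ origin ≡ + 0
      φ-·      : ∀ k v → φ (k · v) ≡ + k * φ v
      ∣φ∣≤∥∥∞  : ∀ v → ℤ.∣ φ v ∣ ≤ ∥ v ∥∞
      unit     : Point d
      φ-unit   : φ unit ≡ + 1

    φ-⊖ : ∀ x v → φ (x ⊖ v) ≡ φ x - φ v
    φ-⊖ x v = begin
      φ (x ⊖ v)                 ≡⟨ add-sub (φ (x ⊖ v)) (φ v) ⟩
      φ (x ⊖ v) + φ v - φ v     ≡⟨ cong (_- φ v) (φ-⊕ (x ⊖ v) v) ⟨
      φ ((x ⊖ v) ⊕ v) - φ v     ≡⟨ cong (λ y → φ y - φ v) (⊖-⊕ x v) ⟩
      φ x - φ v                 ∎
      where
        open ≡-Reasoning
        add-sub : ∀ a b → a ≡ a + b - b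
        add-sub = solve-∀

    φ-sum : ∀ (ps : List (Point d)) →
            φ (List.foldr _⊕_ origin ps) ≡ List.foldr _+_ (+ 0) (List.map φ ps)
    φ-sum List.[]       = φ-origin
    φ-sum (p List.∷ ps) = trans (φ-⊕ p _) (cong (λ s → φ p + s) (φ-sum ps))

  open Direction public

  coordinate : ∀ {d} → Fin d → Direction d
  coordinate i = record
    { φ        = λ x → lookup x i
    ; φ-⊕      = VecP.lookup-zipWith _+_ i
    ; φ-origin = VecP.lookup-replicate i (+ 0)
    ; φ-·      = λ k v → VecP.lookup-map i (+ k *_) v
    ; ∣φ∣≤∥∥∞  = λ v → ∣lookup∣≤∥∥∞ v i
    ; unit     = origin [ i ]≔ + 1
    ; φ-unit   = VecP.lookup∘update i origin (+ 1)
    }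

  opposite : ∀ {d} → Direction d → Direction d
  opposite D = record
    { φ        = λ x → - φ D x
    ; φ-⊕      = λ x y → trans (cong -_ (φ-⊕ D x y)) (ℤP.neg-distrib-+ (φ D x) (φ D y))
    ; φ-origin = cong -_ (φ-origin D)
    ; φ-·      = λ k v → trans (cong -_ (φ-· D k v)) (ℤP.neg-distribʳ-* (+ k) (φ D v))
    ; ∣φ∣≤∥∥∞  = λ v → subst (_≤ ∥ v ∥∞) (sym (ℤP.∣-i∣≡∣i∣ (φ D v))) (∣φ∣≤∥∥∞ D v)
    ; unit     = origin ⊖ unit D
    ; φ-unit   = cong -_ (trans (φ-⊖ D origin (unit D)) (cong₂ _-_ (φ-origin D) (φ-unit D)))
    }

  facing : ∀ {d} (x : Point d) (i : Fin d) → Σ (Direction d) λ D →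
           φ D x ≡ + ℤ.∣ lookup x i ∣ × (∀ n y → InCube n y → φ D y ℤ.≤ + n)
  facing x i with lookup x i in xᵢ≡
  ... | + k      = coordinate i , xᵢ≡ , cube-below
    where
      cube-below : ∀ n y → InCube n y → lookup y i ℤ.≤ + n
      cube-below n y y∈ with InCube-lookup n y y∈ i
      ... | m , yᵢ≡ , m<n = subst (ℤ._≤ + n) (sym yᵢ≡) (ℤ.+≤+ (ℕP.<⇒≤ m<n))
  ... | -[1+ k ] = opposite (coordinate i) , cong -_ xᵢ≡ , cube-below
    where
      cube-below : ∀ n y → InCube n y → - lookup y i ℤ.≤ + n
      cube-below n y y∈ with InCube-lookup n y y∈ i
      ... | m , yᵢ≡ , m<n = subst (λ t → - t ℤ.≤ + n) (sym yᵢ≡) ℤP.neg-≤-pos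

module Cube where

  open import Data.Nat using (ℕ; zero; suc; _+_; _*_; _^_)
  open import Data.Integer using (+_)
  open import Data.Vec using ([]; _∷_)
  open import Data.List using (List; []; _∷_; [_]; length; map; upTo; cartesianProductWith)
  open import Data.List.Properties using (length-++; length-map; length-upTo)
  open import Data.List.Membership.Propositional using (_∈_)
  open import Data.List.Membership.Propositional.Properties using (∈-cartesianProductWith⁺; ∈-upTo⁺)
  open import Data.List.Relation.Unary.Any using (here)
  open import Data.List.Relation.Unary.All using (_∷_)
  open import Data.Product using (_,_)
  open import Relation.Binary.PropositionalEquality using (_≡_; refl; trans; cong₂)

  cube : ∀ d → ℕ → List (Point d)
  cube zero    n = [ [] ]
  cube (suc d) n = cartesianProductWith (λ m y → + m ∷ y) (upTo n) (cube d n)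

  length-cartesianProductWith : ∀ {a b c} {A : Set a} {B : Set b} {C : Set c} (f : A → B → C) xs ys →
    length (cartesianProductWith f xs ys) ≡ length xs * length ys
  length-cartesianProductWith f []       ys = refl
  length-cartesianProductWith f (x ∷ xs) ys =
    trans (length-++ (map (f x) ys))
          (cong₂ _+_ (length-map (f x) ys) (length-cartesianProductWith f xs ys))

  length-cube : ∀ d n → length (cube d n) ≡ n ^ d
  length-cube zero    n = refl
  length-cube (suc d) n =
    trans (length-cartesianProductWith _ (upTo n) (cube d n))
          (cong₂ _*_ (length-upTo n) (length-cube d n))

  ∈-cube : ∀ {d} n (y : Point d) → InCube n y → y ∈ cube d n
  ∈-cube n []      _                    = here refl
  ∈-cube n (z ∷ y) ((m , refl , m<n) ∷ y∈) =
    ∈-cartesianProductWith⁺ (λ m y → + m ∷ y) (∈-upTo⁺ m<n) (∈-cube n y y∈)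

module Toppling {d : ℕ} (S : Sandpile d) where

  open import Data.Nat using (ℕ; _+_; _*_; _∸_; _≤_; _⊔_; z≤n; _≟_; _≤?_)
  import Data.Nat.Properties as ℕP
  open import Data.List as List using (List; _++_; map; concatMap; deduplicate)
  open import Data.List.Membership.Propositional using (_∈_)
  open import Data.List.Membership.Propositional.Properties
    using (∈-map⁺; ∈-++⁺ˡ; ∈-++⁺ʳ; ∈-concatMap⁺; ∈-deduplicate⁺)
  open import Data.List.Relation.Unary.Any as Any using (here; there)
  open import Data.List.Relation.Unary.All as All using ()
  open import Data.List.Relation.Unary.Unique.Propositional using (Unique)
  import Data.List.Relation.Unary.Unique.Propositional.Properties as Unique
  open import Data.List.Relation.Unary.Unique.DecPropositional.Properties using (deduplicate-!)
  open import Data.Product using (∃; _×_; _,_; proj₁; proj₂)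
  open import Data.Sum using (_⊎_; inj₁; inj₂)
  open import Data.Empty using (⊥-elim)
  open import Relation.Nullary using (¬_; yes; no)
  open import Relation.Binary.PropositionalEquality
  open import Relation.Binary.Construct.Closure.ReflexiveTransitive using (fold)
  open Sandpile S
  open ListSums
  open Points

  vec : Point d × ℕ → Point d
  vec = proj₁

  weight : Point d × ℕ → ℕ
  weight = proj₂

  weight≤θ : ∀ {q} → q ∈ nbhd → weight q ≤ θ
  weight≤θ = summand≤sumOver weight nbhd

  θ-positive : ∀ {q} → q ∈ nbhd → 1 ≤ θ
  θ-positive q∈ = ℕP.≤-trans (All.lookup positive q∈) (weight≤θ q∈)

  ∥vec∥≤r : ∀ {q} → q ∈ nbhd → ∥ vec q ∥∞ ≤ r
  ∥vec∥≤r = ≤-maximum nbhd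
    where
      ≤-maximum : ∀ qs {q} → q ∈ qs → ∥ vec q ∥∞ ≤ List.foldr (λ p m → ∥ vec p ∥∞ ⊔ m) 0 qs
      ≤-maximum (p List.∷ qs) (here refl) = ℕP.m≤m⊔n ∥ vec p ∥∞ _
      ≤-maximum (p List.∷ qs) (there q∈)  = ℕP.≤-trans (≤-maximum qs q∈) (ℕP.m≤n⊔m ∥ vec p ∥∞ _)

  -- Since 0 ∉ 𝒩, also r ≥ 1 as soon as the neighbourhood is nonempty.
  r-positive : ∀ {q} → q ∈ nbhd → 1 ≤ r
  r-positive {q} q∈ = ℕP.≤-trans (∥∥∞-positive (vec q) (All.lookup nonzero q∈)) (∥vec∥≤r q∈)

  unstable⇒occupied : ∀ {q a} → q ∈ nbhd → θ ≤ a → a ≢ 0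
  unstable⇒occupied q∈ θ≤a refl with ℕP.≤-trans (θ-positive q∈) θ≤a
  ... | ()

  H-unstable : ∀ {a} → θ ≤ a → H a ≡ 1
  H-unstable {a} θ≤a with θ ≤? a
  ... | yes _   = refl
  ... | no θ≰a = ⊥-elim (θ≰a θ≤a)

  H-stable : ∀ {a} → ¬ θ ≤ a → H a ≡ 0
  H-stable {a} θ≰a with θ ≤? a
  ... | yes θ≤a = ⊥-elim (θ≰a θ≤a)
  ... | no _    = refl

  H≢0⇒unstable : ∀ {a} → H a ≢ 0 → θ ≤ a
  H≢0⇒unstable {a} H≢0 with θ ≤? a
  ... | yes θ≤a = θ≤a
  ... | no _    = ⊥-elim (H≢0 refl)

  θ*H≤ : ∀ a → θ * H a ≤ a
  θ*H≤ a with θ ≤? a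
  ... | yes θ≤a = ℕP.≤-trans (ℕP.≤-reflexive (ℕP.*-identityʳ θ)) θ≤a
  ... | no _    = ℕP.≤-trans (ℕP.≤-reflexive (ℕP.*-zeroʳ θ)) z≤n

  residue : Config → Point d → ℕ
  residue c y = c y ∸ θ * H (c y)

  inflow : Config → Point d → ℕ
  inflow c y = sumOver (λ q → weight q * H (c (y ⊕ vec q))) nbhd

  residue-empty : ∀ c y → c y ≡ 0 → residue c y ≡ 0
  residue-empty c y cy≡0 = trans (cong (λ a → a ∸ θ * H a) cy≡0) (ℕP.0∸n≡0 (θ * H 0))

  inflow-source : ∀ c y → inflow c y ≢ 0 → ∃ λ q → q ∈ nbhd × θ ≤ c (y ⊕ vec q)
  inflow-source c y inflow≢0 with sumOver-nonzero (λ q → weight q * H (c (y ⊕ vec q))) nbhd inflow≢0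
  ... | q , q∈ , wH≢0 = q , q∈ , H≢0⇒unstable (λ H≡0 → wH≢0 (trans (cong (weight q *_) H≡0) (ℕP.*-zeroʳ (weight q))))

  inflow-positive : ∀ c y {q} → q ∈ nbhd → θ ≤ c (y ⊕ vec q) → 1 ≤ inflow c y
  inflow-positive c y {q} q∈ unstable = ℕP.≤-trans (All.lookup positive q∈) (ℕP.≤-trans weight≤wH
    (summand≤sumOver (λ q → weight q * H (c (y ⊕ vec q))) nbhd q∈))
    where
      weight≤wH : weight q ≤ weight q * H (c (y ⊕ vec q))
      weight≤wH = ℕP.≤-reflexive (trans (sym (ℕP.*-identityʳ (weight q))) (cong (weight q *_) (sym (H-unstable unstable))))

  occupied-after : ∀ {c c'} → c ⟶ c' → ∀ y → c' y ≢ 0 →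
                   c y ≢ 0 ⊎ ∃ λ q → q ∈ nbhd × θ ≤ c (y ⊕ vec q)
  occupied-after {c} step y c'y≢0 with c y ≟ 0
  ... | no cy≢0  = inj₁ cy≢0
  ... | yes cy≡0 = inj₂ (inflow-source c y λ inflow≡0 →
                     c'y≢0 (trans (step y) (cong₂ _+_ (residue-empty c y cy≡0) inflow≡0)))

  feeds : ∀ {c c'} → c ⟶ c' → ∀ x {q} → q ∈ nbhd → θ ≤ c x → c' (x ⊖ vec q) ≢ 0
  feeds {c} step x {q} q∈ unstable = ℕP.n>0⇒n≢0 (subst (1 ≤_) (sym (step y))
    (ℕP.≤-trans (inflow-positive c y q∈ unstable′) (ℕP.m≤n+m (inflow c y) (residue c y))))
    where
      y = x ⊖ vec q
      unstable′ : θ ≤ c (y ⊕ vec q)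
      unstable′ = subst (λ z → θ ≤ c z) (sym (⊖-⊕ x (vec q))) unstable

  emptied⇒unstable : ∀ {c c'} → c ⟶ c' → ∀ y → c y ≢ 0 → c' y ≡ 0 → θ ≤ c y
  emptied⇒unstable {c} step y cy≢0 c'y≡0 with θ ≤? c y
  ... | yes θ≤cy = θ≤cy
  ... | no θ≰cy  = ⊥-elim (cy≢0 (ℕP.n≤0⇒n≡0 (subst (c y ≤_) (trans (sym (step y)) c'y≡0) cy≤Fcy)))
    where
      cy≤Fcy : c y ≤ F c y
      cy≤Fcy = ℕP.≤-trans (ℕP.≤-reflexive (sym (cong (c y ∸_) θ*H≡0))) (ℕP.m≤m+n (residue c y) (inflow c y))
        where
          θ*H≡0 : θ * H (c y) ≡ 0
          θ*H≡0 = trans (cong (θ *_) (H-stable θ≰cy)) (ℕP.*-zeroʳ θ)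

  invariant-along : (I : Config → Set) → (∀ {c c'} → c ⟶ c' → I c → I c') →
                    ∀ {c c'} → c ⟶* c' → I c → I c'
  invariant-along I preserve = fold (λ c c' → I c → I c') (λ step rest → rest ∘ preserve step) id
    where open import Function using (_∘_; id)

  Supported : Config → List (Point d) → Set
  Supported c U = ∀ y → c y ≢ 0 → y ∈ U

  MassAtMost : ℕ → Config → Set
  MassAtMost M c = ∃ λ U → Supported c U × sumOver c U ≤ M

  -- After one step, chips can only sit on U or on the sites x - v, x ∈ U.
  spread : List (Point d) → List (Point d)
  spread U = deduplicate _≟ₚ_ (U ++ concatMap (λ x → map (λ q → x ⊖ vec q) nbhd) U)

  spread-supports : ∀ {c c'} → c ⟶ c' → ∀ U → Supported c U → Supported c' (spread U)
  spread-supports step U supp y c'y≢0 with occupied-after step y c'y≢0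
  ... | inj₁ cy≢0 = ∈-deduplicate⁺ _≟ₚ_ (∈-++⁺ˡ (supp y cy≢0))
  ... | inj₂ (q , q∈ , unstable) =
    ∈-deduplicate⁺ _≟ₚ_ (∈-++⁺ʳ U (∈-concatMap⁺ (λ x → map (λ q → x ⊖ vec q) nbhd) (Any.map (λ { refl → y∈ }) x∈U)))
    where
      x∈U : y ⊕ vec q ∈ U
      x∈U = supp (y ⊕ vec q) (unstable⇒occupied q∈ unstable)
      y∈ : y ∈ map (λ q' → (y ⊕ vec q) ⊖ vec q') nbhd
      y∈ = subst (_∈ map (λ q' → (y ⊕ vec q) ⊖ vec q') nbhd) (⊕-⊖ y (vec q))
                 (∈-map⁺ (λ q' → (y ⊕ vec q) ⊖ vec q') q∈)

  residue-total : ∀ c U V → Supported c U → Unique V → sumOver (residue c) V ≤ sumOver (residue c) U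
  residue-total c U V supp V! = sumOver-⊆ (residue c) V U V!
    (λ {y} _ res≢0 → supp y (λ cy≡0 → res≢0 (residue-empty c y cy≡0)))

  -- What a duplicate-free V receives is at most what the sites of U emit:
  -- each unstable x ∈ U sends weight q to the single site x - vec q.
  inflow-total : ∀ c U V → Supported c U → Unique V →
                 sumOver (inflow c) V ≤ sumOver (λ x → θ * H (c x)) U
  inflow-total c U V supp V! = begin
    sumOver (inflow c) V
      ≡⟨ sumOver-swap (λ y q → weight q * H (c (y ⊕ vec q))) V nbhd ⟩
    sumOver (λ q → sumOver (λ y → weight q * H (c (y ⊕ vec q))) V) nbhd
      ≤⟨ sumOver-mono nbhd (λ {q} q∈ → ℕP.≤-trans
           (ℕP.≤-reflexive (sumOver-*ˡ (weight q) (λ y → H (c (y ⊕ vec q))) V))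
           (ℕP.*-monoʳ-≤ (weight q) (translate q∈))) ⟩
    sumOver (λ q → weight q * sumOver (H ∘ c) U) nbhd
      ≡⟨ sumOver-*ʳ (sumOver (H ∘ c) U) weight nbhd ⟩
    θ * sumOver (H ∘ c) U
      ≡⟨ sumOver-*ˡ θ (H ∘ c) U ⟨
    sumOver (λ x → θ * H (c x)) U ∎
    where
      open ℕP.≤-Reasoning
      open import Function using (_∘_)
      translate : ∀ {q} → q ∈ nbhd → sumOver (λ y → H (c (y ⊕ vec q))) V ≤ sumOver (H ∘ c) U
      translate {q} q∈ = subst (_≤ sumOver (H ∘ c) U) (sumOver-map (H ∘ c) (_⊕ vec q) V)
        (sumOver-⊆ (H ∘ c) (map (_⊕ vec q) V) U (Unique.map⁺ (⊕-injective (vec q)) V!)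
          (λ {z} _ H≢0 → supp z (unstable⇒occupied q∈ (H≢0⇒unstable H≢0))))

  total-step : ∀ {c c'} → c ⟶ c' → ∀ U V → Supported c U → Unique V → sumOver c' V ≤ sumOver c U
  total-step {c} {c'} step U V supp V! = begin
    sumOver c' V
      ≡⟨ sumOver-cong V step ⟩
    sumOver (λ y → residue c y + inflow c y) V
      ≡⟨ sumOver-+ (residue c) (inflow c) V ⟩
    sumOver (residue c) V + sumOver (inflow c) V
      ≤⟨ ℕP.+-mono-≤ (residue-total c U V supp V!) (inflow-total c U V supp V!) ⟩
    sumOver (residue c) U + sumOver (λ x → θ * H (c x)) U
      ≡⟨ sumOver-+ (residue c) (λ x → θ * H (c x)) U ⟨
    sumOver (λ x → residue c x + θ * H (c x)) U
      ≡⟨ sumOver-cong U (λ x → ℕP.m∸n+n≡m (θ*H≤ (c x))) ⟩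
    sumOver c U ∎
    where open ℕP.≤-Reasoning

  mass-step : ∀ M {c c'} → c ⟶ c' → MassAtMost M c → MassAtMost M c'
  mass-step M step (U , supp , total≤M) =
    spread U , spread-supports step U supp ,
    ℕP.≤-trans (total-step step U (spread U) supp (deduplicate-! _≟ₚ_ _)) total≤M

-- Completeness forces neighbours on both sides of every direction: writing
-- the unit point of D as a nonnegative combination of neighbours, some
-- neighbour must have positive height.
module Slopes {d : ℕ} (S : Sandpile d) where

  import Data.Nat as ℕ
  open import Data.Integer as ℤ using (+_; _+_; _<_)
  import Data.Integer.Properties as ℤP
  open import Data.List as List using (List; map; foldr; allFin; lookup)
  open import Data.List.Membership.Propositional using (_∈_)
  open import Data.List.Membership.Propositional.Properties using (∈-map⁻; ∈-lookup)
  open import Data.Product using (∃; _×_; _,_)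
  open import Relation.Binary.PropositionalEquality
  open Sandpile S
  open Toppling S using (vec)
  open Directions
  open Integers using (positive-summand; positive-factor)

  uphill : Complete → (D : Direction d) → ∃ λ q → q ∈ nbhd × + 0 < φ D (vec q)
  uphill complete D with complete (unit D)
  ... | k , combination≡unit = positive-term (positive-summand (map (φ D) terms) 0<sum)
    where
      terms : List (Point d)
      terms = map (λ i → k i · vec (lookup nbhd i)) (allFin (List.length nbhd))

      -- φ of the combination is φ (unit D) = 1.
      0<sum : + 0 < foldr _+_ (+ 0) (map (φ D) terms)
      0<sum = subst (+ 0 <_) (trans (sym (φ-unit D)) (trans (cong (φ D) (sym combination≡unit)) (φ-sum D terms)))
                    (ℤ.+<+ (ℕ.s≤s ℕ.z≤n))

      -- A positive value φ (k i · v) = k i * φ v forces φ v > 0.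
      positive-term : (∃ λ a → a ∈ map (φ D) terms × + 0 < a) → ∃ λ q → q ∈ nbhd × + 0 < φ D (vec q)
      positive-term (a , a∈ , 0<a) with ∈-map⁻ (φ D) a∈
      ... | p , p∈ , refl with ∈-map⁻ _ p∈
      ...   | i , _ , refl = lookup nbhd i , ∈-lookup i ,
                             positive-factor (k i) _ (subst (+ 0 <_) (φ-· D (k i) _) 0<a)

  downhill : Complete → (D : Direction d) → ∃ λ q → q ∈ nbhd × φ D (vec q) < + 0
  downhill complete D with uphill complete (opposite D)
  ... | q , q∈ , 0<-φ = q , q∈ , ℤP.neg-cancel-< 0<-φ

-- Firing sites always refill the
-- window just below any level p > B that is exceeded (Gapless), so an
-- occupied site at height > B + 2rm forces more than m occupied sites
-- below it; the chip mass therefore bounds how high chips can climb.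
module Spreading {d : ℕ} (S : Sandpile d) (complete : Sandpile.Complete S)
                 (D : Directions.Direction d) (B : ℤ) where

  open import Data.Nat as ℕ using (ℕ; zero; suc; _≤_; _<_; z≤n; s≤s; _≟_)
  import Data.Nat.Properties as ℕP
  open import Data.Integer as ℤ using (ℤ; +_; _+_; _-_; -_)
  import Data.Integer.Properties as ℤP
  open import Data.List.Membership.Propositional using (_∈_)
  open import Data.Product using (∃; _×_; _,_; proj₁; proj₂)
  open import Data.Sum using (inj₁; inj₂)
  open import Data.Empty using (⊥-elim)
  open import Relation.Nullary using (yes; no)
  open import Relation.Binary.PropositionalEquality
  open Sandpile S
  open Toppling S
  open Slopes S
  open Directions.Direction D
  open Integers
  open Points using (_⊖_)
  open ListSums

  R : ℤ
  R = + r

  φ-vec-within : ∀ {q} → q ∈ nbhd → - R ℤ.≤ φ (vec q) × φ (vec q) ℤ.≤ R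
  φ-vec-within q∈ = ∣∣≤⇒within (ℕP.≤-trans (∣φ∣≤∥∥∞ _) (∥vec∥≤r q∈))

  Gapless : Config → Set
  Gapless c = ∀ p y → c y ≢ 0 → B ℤ.< p → p ℤ.≤ φ y → ∃ λ z → c z ≢ 0 × InWindow R p (φ z)

  gapless-start : ∀ c → (∀ y → c y ≢ 0 → φ y ℤ.≤ B) → Gapless c
  gapless-start c start-below p y cy≢0 B<p p≤φy =
    ⊥-elim (ℤP.<-irrefl refl (ℤP.≤-<-trans (ℤP.≤-trans p≤φy (start-below y cy≢0)) B<p))

  gapless-step : ∀ {c c'} → c ⟶ c' → Gapless c → Gapless c'
  gapless-step {c} {c'} step gapless p y c'y≢0 B<p p≤φy = refill window-before
    where
      -- Before the step some occupied site was at height ≥ p - R: y itself,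
      -- or the unstable site y + v that fed it.
      near-before : ∃ λ s → c s ≢ 0 × p - R ℤ.≤ φ s
      near-before with occupied-after step y c'y≢0
      ... | inj₁ cy≢0 = y , cy≢0 , ℤP.≤-trans (ℤP.i-j≤i p R) p≤φy
      ... | inj₂ (q , q∈ , unstable) = y ⊕ vec q , unstable⇒occupied q∈ unstable ,
              subst (p - R ℤ.≤_) (sym (φ-⊕ y (vec q))) (ℤP.+-mono-≤ p≤φy (proj₁ (φ-vec-within q∈)))

      window-before : ∃ λ t → c t ≢ 0 × InWindow R p (φ t)
      window-before with near-before
      ... | s , cs≢0 , p-R≤φs with φ s ℤP.<? p
      ...   | yes φs<p = s , cs≢0 , near⇒window (ℤ.+≤+ z≤n) p-R≤φs φs<p
      ...   | no φs≮p  = gapless p s cs≢0 B<p (ℤP.≮⇒≥ φs≮p)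

      -- A window site emptied by the step was unstable, and fed a site that
      -- is again in the window: one step down if it was in the upper half,
      -- one step up otherwise.
      refill : (∃ λ t → c t ≢ 0 × InWindow R p (φ t)) → ∃ λ z → c' z ≢ 0 × InWindow R p (φ z)
      refill (t , ct≢0 , t∈W) with c' t ≟ 0
      ... | no c't≢0  = t , c't≢0 , t∈W
      ... | yes c't≡0 = feed-window (emptied⇒unstable step t ct≢0 c't≡0)
        where
          feed-window : θ ≤ c t → ∃ λ z → c' z ≢ 0 × InWindow R p (φ z)
          feed-window unstable with p - R ℤP.≤? φ t | uphill complete D | downhill complete D
          ... | yes upper | qᵘ , qᵘ∈ , 0<φqᵘ | _ =
                t ⊖ vec qᵘ , feeds step t qᵘ∈ unstable ,
                subst (InWindow R p) (sym (φ-⊖ t (vec qᵘ)))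
                      (descend-into-window upper (proj₂ t∈W) 0<φqᵘ (proj₂ (φ-vec-within qᵘ∈)))
          ... | no lower  | _ | qᵈ , qᵈ∈ , φqᵈ<0 =
                t ⊖ vec qᵈ , feeds step t qᵈ∈ unstable ,
                subst (InWindow R p) (sym (φ-⊖ t (vec qᵈ)))
                      (ascend-into-window t∈W (ℤP.≰⇒> lower) (proj₁ (φ-vec-within qᵈ∈)) φqᵈ<0)

  below : Config → ℤ → Point d → ℕ
  below c h x with φ x ℤP.≤? h
  ... | yes _ = c x
  ... | no _  = 0

  below-≤ : ∀ c h x → below c h x ≤ c x
  below-≤ c h x with φ x ℤP.≤? h
  ... | yes _ = ℕP.≤-refl
  ... | no _  = z≤n

  below-mono : ∀ c {h h'} → h ℤ.≤ h' → ∀ x → below c h x ≤ below c h' x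
  below-mono c {h} {h'} h≤h' x with φ x ℤP.≤? h | φ x ℤP.≤? h'
  ... | yes _     | yes _      = ℕP.≤-refl
  ... | yes φx≤h  | no φx≰h'   = ⊥-elim (φx≰h' (ℤP.≤-trans φx≤h h≤h'))
  ... | no _      | _          = z≤n

  below-self : ∀ c x → below c (φ x) x ≡ c x
  below-self c x with φ x ℤP.≤? φ x
  ... | yes _     = refl
  ... | no φx≰φx  = ⊥-elim (φx≰φx ℤP.≤-refl)

  below-under : ∀ c {h} x → h ℤ.< φ x → below c h x ≡ 0
  below-under c {h} x h<φx with φ x ℤP.≤? h
  ... | yes φx≤h = ⊥-elim (ℤP.<-irrefl refl (ℤP.<-≤-trans h<φx φx≤h))
  ... | no _     = refl

  -- An occupied site y at height > B + 2rm has more than m chips at height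
  -- ≤ φ y: the window below φ y contains an occupied site at height > B + 2r(m-1).
  mass-below : ∀ c U → Gapless c → Supported c U → ∀ m y → c y ≢ 0 →
               B + + (m ℕ.* (r ℕ.+ r)) ℤ.< φ y → m < sumOver (below c (φ y)) U
  mass-below c U gapless supp zero y cy≢0 _ =
    ℕP.≤-trans (ℕP.n≢0⇒n>0 (subst (_≢ 0) (sym (below-self c y)) cy≢0))
               (summand≤sumOver (below c (φ y)) U (supp y cy≢0))
  mass-below c U gapless supp (suc m) y cy≢0 high
    with gapless (φ y) y cy≢0 (ℤP.≤-<-trans (ℤP.i≤i+j B _) high) ℤP.≤-refl
  ... | z , cz≢0 , φy-2R≤φz , φz<φy = ℕP.<-≤-trans (s≤s fewer) more
    where
      lower : B + + (m ℕ.* (r ℕ.+ r)) ℤ.< φ z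
      lower = exceeds-after-drop {B} {R + R} {+ (m ℕ.* (r ℕ.+ r))} high φy-2R≤φz
      fewer : m < sumOver (below c (φ z)) U
      fewer = mass-below c U gapless supp m z cz≢0 lower
      more : sumOver (below c (φ z)) U < sumOver (below c (φ y)) U
      more = sumOver-strict U (below-mono c (ℤP.<⇒≤ φz<φy)) (supp y cy≢0)
               (subst₂ _<_ (sym (below-under c y φz<φy)) (sym (below-self c y)) (ℕP.n≢0⇒n>0 cy≢0))

  height-bound : ∀ M c → Gapless c → MassAtMost M c → ∀ y → c y ≢ 0 → φ y ℤ.≤ B + + (M ℕ.* (r ℕ.+ r))
  height-bound M c gapless (U , supp , total≤M) y cy≢0 with φ y ℤP.≤? B + + (M ℕ.* (r ℕ.+ r))
  ... | yes low   = low
  ... | no too-high = ⊥-elim (ℕP.<-irrefl refl (ℕP.<-≤-trans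
          (mass-below c U gapless supp M y cy≢0 (ℤP.≰⇒> too-high))
          (ℕP.≤-trans (sumOver-mono U (λ {x} _ → below-≤ c (φ y) x)) total≤M)))

  reach-bound : ∀ M {c c'} → (∀ y → c y ≢ 0 → φ y ℤ.≤ B) → MassAtMost M c → c ⟶* c' →
                ∀ y → c' y ≢ 0 → φ y ℤ.≤ B + + (M ℕ.* (r ℕ.+ r))
  reach-bound M {c} start-below mass steps =
    height-bound M _ (invariant-along Gapless gapless-step steps (gapless-start c start-below))
                     (invariant-along (MassAtMost M) (mass-step M) steps mass)

module Hypercube {d : ℕ} (S : Sandpile d) where

  open import Data.Nat as ℕ using (_+_; _*_; _^_; _≤_; _<_; pred)
  import Data.Nat.Properties as ℕP
  open import Data.Integer as ℤ using (+_)
  import Data.Integer.Properties as ℤP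
  open import Data.Vec using (lookup)
  open import Data.Fin using (Fin)
  open import Data.Product using (_,_)
  open import Relation.Binary.PropositionalEquality
  open Sandpile S
  open Toppling S
  open ListSums
  open Cube
  open Directions

  cube-mass : ∀ n b (c : Config) → (∀ x → c x ≢ 0 → InCube n x) → (∀ x → c x ≤ b) →
              MassAtMost (n ^ d * b) c
  cube-mass n b c supp c≤b =
    cube d n , (λ y cy≢0 → ∈-cube n y (supp y cy≢0)) ,
    subst (λ L → sumOver c (cube d n) ≤ L * b) (length-cube d n) (sumOver-const c b (cube d n) c≤b)

  -- Every coordinate of an occupied site stays within n + 2r·n^d·(2θ - 1),
  -- where 2θ - 1 = pred (2θ) bounds the initial number of chips per site.
  coordinate-bound : Complete → ∀ n c c' → (∀ x → c x ≢ 0 → InCube n x) → (∀ x → c x < 2 * θ) →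
                     c ⟶* c' → ∀ x (i : Fin d) → c' x ≢ 0 →
                     ℤ.∣ lookup x i ∣ ≤ n + n ^ d * pred (2 * θ) * (r + r)
  coordinate-bound complete n c c' supp small steps x i c'x≢0 with facing x i
  ... | D , φx≡∣xᵢ∣ , cube-low = ℤP.drop‿+≤+ (subst (ℤ._≤ + (n + n ^ d * pred (2 * θ) * (r + r))) φx≡∣xᵢ∣
          (Spreading.reach-bound S complete D (+ n) (n ^ d * pred (2 * θ))
             (λ y cy≢0 → cube-low n y (supp y cy≢0))
             (cube-mass n (pred (2 * θ)) c supp (λ x → ℕP.suc[m]≤n⇒m≤pred[n] (small x)))
             steps x c'x≢0))

open import Data.Nat using (zero; suc; _+_; _*_; _^_; _≤_; _<_; z≤n; pred; _≟_)
import Data.Nat.Properties as ℕP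
open import Data.Fin using (Fin)
open import Data.Product using (_,_)
open import Data.Empty using (⊥-elim)
open import Relation.Nullary using (yes; no)
open import Relation.Binary.PropositionalEquality using (_≡_; _≢_; refl)

budget : ∀ n N θ r → 1 ≤ θ → 1 ≤ r → n ≤ N → n + N * pred (2 * θ) * (r + r) ≤ 4 * θ * r * N
budget n N (suc t) (suc s) _ _ n≤N = begin
  n + N * pred (2 * suc t) * (suc s + suc s)
    ≤⟨ ℕP.+-monoˡ-≤ (N * pred (2 * suc t) * (suc s + suc s)) (ℕP.≤-trans n≤N (ℕP.m≤n*m N (suc s + suc s))) ⟩
  (suc s + suc s) * N + N * pred (2 * suc t) * (suc s + suc s)
    ≡⟨ expand t s N ⟩
  4 * suc t * suc s * N ∎
  where
    open ℕP.≤-Reasoning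
    open import Data.Nat.Tactic.RingSolver using (solve-∀)
    -- pred (2 * suc t) computes to t + suc (t + 0).
    expand : ∀ t s N → (suc s + suc s) * N + N * (t + suc (t + 0)) * (suc s + suc s) ≡ 4 * suc t * suc s * N
    expand = solve-∀

n≤n^d : ∀ {d} → Fin d → ∀ n → n ≤ n ^ d
n≤n^d {suc d} _ zero    = z≤n
n≤n^d {suc d} _ (suc n) = ℕP.m≤m*n (suc n) (suc n ^ d) {{ℕP.m^n≢0 (suc n) d}}

-- Lemma 3.  Suppose c' x ≠ 0 with |x|∞ > 4θrn^d, and pick a coordinate i
-- with |xᵢ| > 4θrn^d.  The coordinate bound in the direction facing xᵢ gives
-- |xᵢ| ≤ n + 2rn^d(2θ - 1) ≤ 4θrn^d, since θ, r, d ≥ 1 (completeness provides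
-- a neighbour, and i witnesses d ≥ 1).
lemma3 : ∀ {d : ℕ} (S : Sandpile d) → Sandpile.Complete S →
    ∀ (n : ℕ) (c c' : Sandpile.Config S) →
    (∀ x → c x ≢ 0 → InCube n x) →
    (∀ x → c x < 2 * Sandpile.θ S) →
    Sandpile._⟶*_ S c c' →
    ∀ x → 4 * Sandpile.θ S * Sandpile.r S * n ^ d < ∥ x ∥∞ → c' x ≡ 0
lemma3 {d} S complete n c c' supp small steps x far with c' x ≟ 0
... | yes c'x≡0 = c'x≡0
... | no c'x≢0 with Points.∥∥∞-attained x _ far
...   | i , far-i with Slopes.uphill S complete (Directions.coordinate i)
...     | q , q∈ , _ = ⊥-elim (ℕP.<-irrefl refl (ℕP.<-≤-trans far-i (ℕP.≤-trans
            (Hypercube.coordinate-bound S complete n c c' supp small steps x i c'x≢0)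
            (budget n (n ^ d) θ r (θ-positive q∈) (r-positive q∈) (n≤n^d i n)))))
  where
    open Sandpile S using (θ; r)
    open Toppling S using (θ-positive; r-positive)
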